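{- Let $p\geq2$, $d=2p$, and let $G$ be a $2p$-angulation of girth $2p$ with external vertices $u_1,\dots,u_{2p}$ in clockwise order, whose vertices are properly colored black and white with $u_1$ black. A clockwise labelling of $G$ is even if and only if every corner incident to a black vertex has an odd color and every corner incident to a white vertex has an even color.
   Context: Graphs are finite, loopless, possibly with multiple edges. A plane graph is a connected planar graph with a fixed crossing-free drawing; the unbounded face is external; vertices/edges on it are external, others internal. A corner is a pair of consecutive edges around a vertex. A $2p$-angulation is a plane graph all of whose faces have degree $2p$; such a graph is bipartite, hence its vertices admit a proper black/white coloring. Clockwise order around an internal face: walk with the face on the right; around the external face: with it on the left. $[d]=\{1,\dots,d\}$ with arithmetic mod $d$. A clockwise labelling of $G$ assigns a color in $[d]$ to each corner such that: (i) consecutive corners in clockwise order around any face have colors $c,c+1$ (mod $d$); (ii) all corners at $u_i$ have color $i$; (iii) in clockwise order around each internal vertex exactly one corner has larger color (as an integer in $\{1,\dots,d\}$) than the next one. For an arc $(u,e)$, the clockwise-jump across it is the element of $\{0,\dots,d-1\}$ congruent mod $d$ to $\ell_2-\ell_1$, where $\ell_1,\ell_2$ are the colors of the corners preceding and following $e$ clockwise around $u$. A clockwise labelling is even if the clockwise-jump across every arc of every internal edge is even (equivalently, the associated $d/(d-2)$-orientation whose arc values are these jumps has all values even). -}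

module Defs where

open import Data.Nat using (ℕ; zero; suc; _+_; _*_; _≤_; _<_)
open import Data.Nat.Divisibility using (_∣_)
open import Data.Fin using (Fin; toℕ)
open import Data.Fin.Permutation using (Permutation′; _⟨$⟩ʳ_; _⟨$⟩ˡ_)
open import Data.Bool using (Bool; true; false)
open import Data.Product using (Σ; ∃; _×_; _,_)
open import Data.Sum using (_⊎_)
open import Function using (Surjective)
open import Function.Bundles using (_⇔_)
open import Relation.Nullary using (¬_)
open import Relation.Binary.PropositionalEquality using (_≡_; _≢_)

iter : ∀ {A : Set} → (A → A) → ℕ → A → A
iter f zero    x = x
iter f (suc k) x = f (iter f k x)

Even : ℕ → Set
Even n = 2 ∣ n

Odd : ℕ → Set
Odd n = ¬ (2 ∣ n)

-- Congruent d a b  means  a ≡ b (mod d), for naturals, without truncated subtraction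
Congruent : ℕ → ℕ → ℕ → Set
Congruent d a b = Σ ℕ λ k → (a + k * d ≡ b) ⊎ (b + k * d ≡ a)

-- A map with n darts (half-edges) Fin n is given by
--   σ : the rotation, σ h = the next dart CLOCKWISE around the vertex of h,
--   α : the edge involution, α h = the other half of the edge of h.
-- Vertices = σ-orbits, edges = α-orbits.
--
-- Corners: the corner between consecutive darts (σ⁻¹ k , k) clockwise around
-- a vertex is identified with the dart k (its SECOND dart).  So the corner
-- following corner k clockwise around its vertex is σ k.
--
-- Walking along the dart σ⁻¹ k with the face of corner
-- k on the right, one reaches corner φ k.  Hence faces = φ-orbits, and the
-- φ-order is the clockwise order around an internal face (face on the right),
-- while φ⁻¹ is the clockwise order around the external face (face on the left).

record Map (n : ℕ) : Set where
  field
    σ : Permutation′ n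
    α : Permutation′ n

  σ⁺ σ⁻ α⁺ : Fin n → Fin n
  σ⁺ h = σ ⟨$⟩ʳ h
  σ⁻ h = σ ⟨$⟩ˡ h
  α⁺ h = α ⟨$⟩ʳ h

  φ⁺ φ⁻ : Fin n → Fin n
  φ⁺ k = α⁺ (σ⁻ k)
  φ⁻ k = σ⁺ (α ⟨$⟩ˡ k)

open Map public

SameOrbit : ∀ {n} → (Fin n → Fin n) → Fin n → Fin n → Set
SameOrbit f h k = Σ ℕ λ i → iter f i h ≡ k

HasOrbitCount : ∀ {n} → (Fin n → Fin n) → ℕ → Set
HasOrbitCount {n} f m =
  Σ (Fin n → Fin m) λ o → Surjective _≡_ _≡_ o ×
    (∀ h k → (o h ≡ o k) ⇔ SameOrbit f h k)

module _ {n : ℕ} (G : Map n) where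

  SameVertex SameFace : Fin n → Fin n → Set
  SameVertex = SameOrbit (σ⁺ G)
  SameFace   = SameOrbit (φ⁺ G)

  IsEdgeInvolution : Set
  IsEdgeInvolution = (∀ h → α⁺ G (α⁺ G h) ≡ h) × (∀ h → α⁺ G h ≢ h)

  Loopless : Set
  Loopless = ∀ h → ¬ SameVertex h (α⁺ G h)

  data Reach (h : Fin n) : Fin n → Set where
    here : Reach h h
    stepσ : ∀ {k} → Reach h k → Reach h (σ⁺ G k)
    stepα : ∀ {k} → Reach h k → Reach h (α⁺ G k)

  Connected : Set
  Connected = ∀ h k → Reach h k

  -- genus 0: Euler's formula V − E + F = 2, with E = n/2, i.e. 2V + 2F = n + 4
  Planar : Set
  Planar = Σ ℕ λ V → Σ ℕ λ F →
    HasOrbitCount (σ⁺ G) V × HasOrbitCount (φ⁺ G) F × (2 * V + 2 * F ≡ n + 4)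

  IsPlaneGraph : Set
  IsPlaneGraph = IsEdgeInvolution × Loopless × Connected × Planar

  AllFacesDegree : ℕ → Set
  AllFacesDegree D = ∀ k → iter (φ⁺ G) D k ≡ k × (∀ i → 0 < i → i < D → iter (φ⁺ G) i k ≢ k)

  -- a cycle of length L: darts c 0 … c (L-1), dart c i leads from the vertex of
  -- c i to the vertex of c (i+1 mod L); the L vertices are pairwise distinct and
  -- consecutive edges are distinct (relevant only for L = 2, multiple edges).
  IsCycle : (L : ℕ) → (Fin L → Fin n) → (Fin L → Fin L) → Set
  IsCycle L c nxt =
    (∀ i → SameVertex (α⁺ G (c i)) (c (nxt i))) ×
    (∀ i → c (nxt i) ≢ α⁺ G (c i)) ×
    (∀ i j → SameVertex (c i) (c j) → i ≡ j)

  CyclicSucc : (L : ℕ) → (Fin L → Fin L) → Set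
  CyclicSucc L nxt = ∀ i → toℕ (nxt i) ≡ suc (toℕ i) ⊎ (suc (toℕ i) ≡ L × toℕ (nxt i) ≡ 0)

  HasCycleOfLength : ℕ → Set
  HasCycleOfLength L = Σ (Fin L → Fin n) λ c → Σ (Fin L → Fin L) λ nxt →
    CyclicSucc L nxt × IsCycle L c nxt

  HasGirth : ℕ → Set
  HasGirth g = HasCycleOfLength g × (∀ L → 2 ≤ L → L < g → ¬ HasCycleOfLength L)

  -- The external face is the face of the root corner r.
  module _ (r : Fin n) where

    ExternalCorner : Fin n → Set
    ExternalCorner k = SameFace r k

    InternalVertex : Fin n → Set
    InternalVertex h = ∀ k → SameVertex h k → ¬ ExternalCorner k

    InternalEdge : Fin n → Set
    InternalEdge h = ¬ ExternalCorner (σ⁺ G h) × ¬ ExternalCorner (σ⁺ G (α⁺ G h))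

    -- clockwise order around the external face is φ⁻¹ (face on the left);
    -- the external vertex u_(i+1) (i : Fin D) is the vertex of corner φ⁻ⁱ r.
    externalCorner : ℕ → Fin n
    externalCorner i = iter (φ⁻ G) i r

    -- A clockwise labelling with colours in [d] = {1,…,d} (ℓ assigns a colour
    -- to each corner); the external face has d corners u_1,…,u_d.
    IsClockwiseLabelling : (d : ℕ) → (Fin n → ℕ) → Set
    IsClockwiseLabelling d ℓ =
      (∀ k → 1 ≤ ℓ k × ℓ k ≤ d) ×
      -- (i) internal faces, clockwise order = φ
      (∀ k → ¬ ExternalCorner k → Congruent d (ℓ (φ⁺ G k)) (ℓ k + 1)) ×
      -- (i) external face, clockwise order = φ⁻¹
      (∀ k → ExternalCorner k → Congruent d (ℓ (φ⁻ G k)) (ℓ k + 1)) ×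
      -- (ii) all corners at u_(i+1) have colour i+1
      (∀ (i : Fin d) k → SameVertex (externalCorner (toℕ i)) k → ℓ k ≡ suc (toℕ i)) ×
      (∀ h → InternalVertex h →
         Σ (Fin n) λ k → SameVertex h k × ℓ (σ⁺ G k) < ℓ k ×
           (∀ k' → SameVertex h k' → ℓ (σ⁺ G k') < ℓ k' → k' ≡ k))

    IsJump : (d a b j : ℕ) → Set
    IsJump d a b j = j < d × Congruent d (a + j) b

    -- the jump across arc h (dart h at its vertex) is between the corner h
    -- preceding h and the corner σ h following h clockwise
    IsEvenLabelling : (d : ℕ) → (Fin n → ℕ) → Set
    IsEvenLabelling d ℓ =
      ∀ h → InternalEdge h → ∀ j → IsJump d (ℓ h) (ℓ (σ⁺ G h)) j → Even j

  -- proper black/white vertex colouring (black = true)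
  IsProperColouring : (Fin n → Bool) → Set
  IsProperColouring col = (∀ h → col (σ⁺ G h) ≡ col h) × (∀ h → col (α⁺ G h) ≢ col h)

module Submission where

-- Call a corner k *agreeing* if the parity of its colour ℓ k is the shade of
-- its vertex (black = odd, white = even).  The theorem says: the labelling is
-- even iff every corner agrees.
--
-- (⇐) If all corners agree, the two corners around an arc lie at the same
--     vertex, so their colours have equal parity; since d = 2p is even, the
--     clockwise-jump between them (a difference mod d) is then even.
-- (⇒) Agreement propagates through the whole map from the root corner:
--     * corners at external vertices agree, by rule (ii) and because the
--       external vertices u₁, u₂, … alternate black, white, …;
--     * one face step φ flips both the colour parity (rule (i), d even) and
--       the shade (proper colouring), so it preserves agreement;
--     * one rotation step σ preserves agreement: across an internal edge the
--       jump is even, otherwise one of its ends is an external vertex.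
--     Since α = φ ∘ σ and the map is connected, every corner agrees.

open import Defs
open import Data.Nat using (ℕ; _*_; _≤_)
open import Data.Fin using (Fin)
open import Data.Bool using (Bool; true; false)
open import Data.Product using (_×_)
open import Function.Bundles using (_⇔_)
open import Relation.Binary.PropositionalEquality using (_≡_)

open import Data.Nat using (zero; suc; _+_; _∸_; _<_; _≤?_; z≤n; s≤s; parity)
open import Data.Nat.Properties
  using (≤-refl; <-trans; n<1+n; m<n+m; m≤n+m; m≤n*m; ≤-trans; <⇒≤; ≰⇒>;
         m+[n∸m]≡n; +-identityʳ; +-cancelˡ-<; +-monoˡ-<; anyUpTo?; module ≤-Reasoning)
open import Data.Nat.Divisibility using (divides; m∣m*n; n∣m*n; ∣-trans)
open import Data.Fin using (_≟_; toℕ; fromℕ<)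
open import Data.Fin.Properties using (toℕ-fromℕ<)
open import Data.Fin.Permutation using (inverseˡ; inverseʳ; _⟨$⟩ˡ_)
open import Data.Parity.Base using (Parity; 0ℙ; 1ℙ; _⁻¹) renaming (_+_ to _⊕_)
import Data.Parity.Properties as ℙ
open import Data.Product using (∃; _,_; proj₁; proj₂)
open import Data.Sum using (inj₁; inj₂)
open import Data.Empty using (⊥-elim)
open import Relation.Nullary using (Dec; yes; no; ¬_)
open import Relation.Nullary.Decidable using (map′)
open import Function.Bundles using (mk⇔; Equivalence)
open import Relation.Binary.PropositionalEquality
  using (refl; sym; trans; cong; subst; _≢_; module ≡-Reasoning)

open Equivalence using (to; from)

shade : Bool → Parity
shade true  = 1ℙ
shade false = 0ℙ

shade-≢ : ∀ {b c} → b ≢ c → shade b ≡ shade c ⁻¹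
shade-≢ {true}  {true}  b≢c = ⊥-elim (b≢c refl)
shade-≢ {true}  {false} _   = refl
shade-≢ {false} {true}  _   = refl
shade-≢ {false} {false} b≢c = ⊥-elim (b≢c refl)

even⇒parity≡0 : ∀ {m} → Even m → parity m ≡ 0ℙ
even⇒parity≡0 (divides q refl) = trans (ℙ.*-homo-* q 2) (ℙ.*-zeroʳ (parity q))

parity≡0⇒even : ∀ m → parity m ≡ 0ℙ → Even m
parity≡0⇒even zero          _  = divides 0 refl
parity≡0⇒even (suc zero)    ()
parity≡0⇒even (suc (suc m)) eq with parity≡0⇒even m eq
... | divides q refl = divides (suc q) refl

odd⇒parity≡1 : ∀ m → Odd m → parity m ≡ 1ℙ
odd⇒parity≡1 m odd with parity m in eq
... | 0ℙ = ⊥-elim (odd (parity≡0⇒even m eq))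
... | 1ℙ = refl

parity≡1⇒odd : ∀ {m} → parity m ≡ 1ℙ → Odd m
parity≡1⇒odd p≡1 m-even with trans (sym p≡1) (even⇒parity≡0 m-even)
... | ()

parity≡shade⇔ : ∀ m b → parity m ≡ shade b ⇔ ((b ≡ true → Odd m) × (b ≡ false → Even m))
parity≡shade⇔ m true  = mk⇔ (λ p≡1 → (λ _ → parity≡1⇒odd p≡1) , λ ())
                           (λ (odd , _) → odd⇒parity≡1 m (odd refl))
parity≡shade⇔ m false = mk⇔ (λ p≡0 → (λ ()) , λ _ → parity≡0⇒even m p≡0)
                           (λ (_ , even) → even⇒parity≡0 (even refl))

parity-+1 : ∀ m → parity (m + 1) ≡ parity m ⁻¹
parity-+1 m = trans (ℙ.+-homo-+ m 1) (⊕1ℙ (parity m))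
  where
  ⊕1ℙ : ∀ q → q ⊕ 1ℙ ≡ q ⁻¹
  ⊕1ℙ 0ℙ = refl
  ⊕1ℙ 1ℙ = refl

parity-congruent : ∀ {d a b} → Even d → Congruent d a b → parity a ≡ parity b
parity-congruent {d} {a} d-even (k , inj₁ a+kd≡b) =
  trans (sym (parity-+-multiple a k)) (cong parity a+kd≡b)
  where
  parity-+-multiple : ∀ a k → parity (a + k * d) ≡ parity a
  parity-+-multiple a k = begin
    parity (a + k * d)        ≡⟨ ℙ.+-homo-+ a (k * d) ⟩
    parity a ⊕ parity (k * d) ≡⟨ cong (parity a ⊕_) (even⇒parity≡0 (∣-trans d-even (n∣m*n k))) ⟩
    parity a ⊕ 0ℙ             ≡⟨ ℙ.+-identityʳ (parity a) ⟩
    parity a                  ∎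
    where open ≡-Reasoning
parity-congruent d-even (k , inj₂ b+kd≡a) = sym (parity-congruent d-even (k , inj₁ b+kd≡a))

jump-even⇔ : ∀ {d a b j} → Even d → Congruent d (a + j) b → Even j ⇔ (parity a ≡ parity b)
jump-even⇔ {a = a} {b} {j} d-even c = mk⇔
  (λ j-even → sym (trans parity-b (trans (cong (parity a ⊕_) (even⇒parity≡0 j-even))
                                         (ℙ.+-identityʳ (parity a)))))
  (λ pa≡pb → parity≡0⇒even j (ℙ.+-cancelˡ-≡ (parity a) (parity j) 0ℙ
               (trans (sym parity-b) (trans (sym pa≡pb) (sym (ℙ.+-identityʳ (parity a)))))))
  where
  parity-b : parity b ≡ parity a ⊕ parity j
  parity-b = trans (sym (parity-congruent d-even c)) (ℙ.+-homo-+ a j)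

flip-agree : ∀ {p p′ q q′ : Parity} → p ≡ p′ ⁻¹ → q ≡ q′ ⁻¹ → (p ≡ q) ⇔ (p′ ≡ q′)
flip-agree p≡p′⁻¹ q≡q′⁻¹ = mk⇔
  (λ p≡q → ℙ.⁻¹-injective (trans (sym p≡p′⁻¹) (trans p≡q q≡q′⁻¹)))
  (λ p′≡q′ → trans p≡p′⁻¹ (trans (cong _⁻¹ p′≡q′) (sym q≡q′⁻¹)))

jump-exists : ∀ {d a b} → 0 < a → a ≤ d → b ≤ d → ∃ λ j → j < d × Congruent d (a + j) b
jump-exists {d} {a} {b} 0<a a≤d b≤d with a ≤? b
... | yes a≤b = b ∸ a , +-cancelˡ-< a (b ∸ a) d a+j<a+d , 0 , inj₁ a+j+0≡b
  where
  open ≤-Reasoning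
  a+j<a+d : a + (b ∸ a) < a + d
  a+j<a+d = begin-strict
    a + (b ∸ a) ≡⟨ m+[n∸m]≡n a≤b ⟩
    b           ≤⟨ b≤d ⟩
    d           <⟨ m<n+m d 0<a ⟩
    a + d       ∎
  a+j+0≡b : a + (b ∸ a) + 0 ≡ b
  a+j+0≡b = trans (+-identityʳ (a + (b ∸ a))) (m+[n∸m]≡n a≤b)
... | no a≰b = (b + d) ∸ a , +-cancelˡ-< a _ d a+j<a+d , 1 , inj₂ b+d≡a+j
  where
  a≤b+d : a ≤ b + d
  a≤b+d = ≤-trans a≤d (m≤n+m d b)
  a+j<a+d : a + ((b + d) ∸ a) < a + d
  a+j<a+d = subst (_< a + d) (sym (m+[n∸m]≡n a≤b+d)) (+-monoˡ-< d (≰⇒> a≰b))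
  b+d≡a+j : b + 1 * d ≡ a + ((b + d) ∸ a)
  b+d≡a+j = trans (cong (b +_) (+-identityʳ d)) (sym (m+[n∸m]≡n a≤b+d))

iter-+ : ∀ {A : Set} (f : A → A) m n x → iter f (m + n) x ≡ iter f m (iter f n x)
iter-+ f zero    n x = refl
iter-+ f (suc m) n x = cong f (iter-+ f m n x)

iter-sucʳ : ∀ {A : Set} (f : A → A) n x → iter f (suc n) x ≡ iter f n (f x)
iter-sucʳ f zero    x = refl
iter-sucʳ f (suc n) x = cong f (iter-sucʳ f n x)

iter-cancel : ∀ {A : Set} (f g : A → A) → (∀ x → g (f x) ≡ x) → ∀ n x → iter g n (iter f n x) ≡ x
iter-cancel f g g∘f zero    x = refl
iter-cancel f g g∘f (suc n) x = begin
  iter g (suc n) (f (iter f n x)) ≡⟨ iter-sucʳ g n _ ⟩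
  iter g n (g (f (iter f n x)))   ≡⟨ cong (iter g n) (g∘f _) ⟩
  iter g n (iter f n x)           ≡⟨ iter-cancel f g g∘f n x ⟩
  x                               ∎
  where open ≡-Reasoning

-- when the orbits of f are counted, they form a partition, so SameOrbit is symmetric
sameOrbit-sym : ∀ {n} {f : Fin n → Fin n} {m} → HasOrbitCount f m →
  ∀ {h k} → SameOrbit f h k → SameOrbit f k h
sameOrbit-sym (_ , _ , orbit≡) {h} {k} h~k = to (orbit≡ k h) (sym (from (orbit≡ h k) h~k))

module MapFacts {n : ℕ} (G : Map n) where

  φ⁻-φ⁺ : ∀ k → φ⁻ G (φ⁺ G k) ≡ k
  φ⁻-φ⁺ k = trans (cong (σ⁺ G) (inverseˡ (α G))) (inverseʳ (σ G))

  φ⁺-φ⁻ : ∀ k → φ⁺ G (φ⁻ G k) ≡ k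
  φ⁺-φ⁻ k = trans (cong (α⁺ G) (inverseˡ (σ G))) (inverseʳ (α G))

  φ⁺-σ : ∀ k → φ⁺ G (σ⁺ G k) ≡ α⁺ G k
  φ⁺-σ k = cong (α⁺ G) (inverseˡ (σ G))

  reach-ind : (P : Fin n → Set) {r : Fin n} → P r →
    (∀ k → P k → P (σ⁺ G k)) → (∀ k → P k → P (α⁺ G k)) → ∀ {k} → Reach G r k → P k
  reach-ind P Pr Pσ Pα here       = Pr
  reach-ind P Pr Pσ Pα (stepσ rk) = Pσ _ (reach-ind P Pr Pσ Pα rk)
  reach-ind P Pr Pσ Pα (stepα rk) = Pα _ (reach-ind P Pr Pσ Pα rk)

  module Colouring {col : Fin n → Bool} (proper : IsProperColouring G col) where

    colour-iter-σ : ∀ i h → col (iter (σ⁺ G) i h) ≡ col h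
    colour-iter-σ zero    h = refl
    colour-iter-σ (suc i) h = trans (proj₁ proper _) (colour-iter-σ i h)

    colour-sameVertex : ∀ {h k} → SameVertex G h k → col k ≡ col h
    colour-sameVertex {h} (i , refl) = colour-iter-σ i h

    colour-φ⁺ : ∀ k → col (φ⁺ G k) ≢ col k
    colour-φ⁺ k eq = proj₂ proper (σ⁻ G k)
      (trans eq (trans (cong col (sym (inverseʳ (σ G)))) (proj₁ proper (σ⁻ G k))))

    colour-φ⁻ : ∀ k → col (φ⁻ G k) ≢ col k
    colour-φ⁻ k eq = proj₂ proper (α G ⟨$⟩ˡ k)
      (trans (cong col (inverseʳ (α G))) (trans (sym eq) (proj₁ proper _)))

  module ExternalFace (r : Fin n) {D : ℕ} (0<D : 0 < D) (faceCycle : iter (φ⁺ G) D r ≡ r) where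

    OnExternalWalk : Fin n → Set
    OnExternalWalk k = ∃ λ j → j < D × externalCorner G r j ≡ k

    backCycle : iter (φ⁻ G) D r ≡ r
    backCycle = trans (cong (iter (φ⁻ G) D) (sym faceCycle)) (iter-cancel (φ⁺ G) (φ⁻ G) φ⁻-φ⁺ D r)

    walk-φ⁺ : ∀ {k} → OnExternalWalk k → OnExternalWalk (φ⁺ G k)
    walk-φ⁺ (suc j , j<D , eq) = j , <-trans (n<1+n j) j<D , trans (sym (φ⁺-φ⁻ _)) (cong (φ⁺ G) eq)
    walk-φ⁺ (zero , _ , refl) = lastCorner D ≤-refl 0<D backCycle
      where
      lastCorner : ∀ m → m ≤ D → 0 < m → iter (φ⁻ G) m r ≡ r → OnExternalWalk (φ⁺ G r)
      lastCorner (suc m) m<D _ cycle = m , m<D , trans (sym (φ⁺-φ⁻ _)) (cong (φ⁺ G) cycle)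

    external⇒walk : ∀ {k} → ExternalCorner G r k → OnExternalWalk k
    external⇒walk (i , refl) = walk i
      where
      walk : ∀ i → OnExternalWalk (iter (φ⁺ G) i r)
      walk zero    = 0 , 0<D , refl
      walk (suc i) = walk-φ⁺ (walk i)

    walk⇒external : ∀ {k} → OnExternalWalk k → ExternalCorner G r k
    walk⇒external (j , j<D , refl) = D ∸ j , (begin
      iter (φ⁺ G) (D ∸ j) r                                ≡⟨ sym (iter-cancel (φ⁺ G) (φ⁻ G) φ⁻-φ⁺ j _) ⟩
      iter (φ⁻ G) j (iter (φ⁺ G) j (iter (φ⁺ G) (D ∸ j) r)) ≡⟨ cong (iter (φ⁻ G) j) (sym (iter-+ (φ⁺ G) j (D ∸ j) r)) ⟩
      iter (φ⁻ G) j (iter (φ⁺ G) (j + (D ∸ j)) r)           ≡⟨ cong (λ m → iter (φ⁻ G) j (iter (φ⁺ G) m r)) (m+[n∸m]≡n (<⇒≤ j<D)) ⟩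
      iter (φ⁻ G) j (iter (φ⁺ G) D r)                       ≡⟨ cong (iter (φ⁻ G) j) faceCycle ⟩
      iter (φ⁻ G) j r                                       ∎)
      where open ≡-Reasoning

    -- being external is decidable: it is a search among D candidates
    external? : ∀ k → Dec (ExternalCorner G r k)
    external? k = map′ walk⇒external external⇒walk (anyUpTo? (λ j → externalCorner G r j ≟ k) D)

module Agreement {n : ℕ} (G : Map n) (r : Fin n) {D : ℕ} (0<D : 0 < D) (D-even : Even D)
  (faceCycle : iter (φ⁺ G) D r ≡ r)
  (sameVertex-sym : ∀ {h k} → SameVertex G h k → SameVertex G k h)
  {col : Fin n → Bool} (proper : IsProperColouring G col) (r-black : col r ≡ true)
  {ℓ : Fin n → ℕ} (labelling : IsClockwiseLabelling G r D ℓ) where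

  open MapFacts G
  open Colouring proper
  open ExternalFace r 0<D faceCycle

  colours-in-range : ∀ k → 1 ≤ ℓ k × ℓ k ≤ D
  colours-in-range = proj₁ labelling

  internal-face-rule : ∀ k → ¬ ExternalCorner G r k → Congruent D (ℓ (φ⁺ G k)) (ℓ k + 1)
  internal-face-rule = proj₁ (proj₂ labelling)

  external-vertex-rule : ∀ (i : Fin D) k →
    SameVertex G (externalCorner G r (toℕ i)) k → ℓ k ≡ suc (toℕ i)
  external-vertex-rule = proj₁ (proj₂ (proj₂ (proj₂ labelling)))

  Agrees : Fin n → Set
  Agrees k = parity (ℓ k) ≡ shade (col k)

  -- u_(j+1) has colour j+1 and, the external vertices alternating from the
  -- black u₁, it is black exactly when j+1 is odd
  shade-externalCorner : ∀ j → parity (suc j) ≡ shade (col (externalCorner G r j))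
  shade-externalCorner zero    = cong shade (sym r-black)
  shade-externalCorner (suc j) = begin
    parity j                                        ≡⟨ sym (ℙ.suc-homo-⁻¹ j) ⟩
    parity (suc j) ⁻¹                               ≡⟨ cong _⁻¹ (shade-externalCorner j) ⟩
    shade (col (externalCorner G r j)) ⁻¹           ≡⟨ sym (shade-≢ (colour-φ⁻ _)) ⟩
    shade (col (φ⁻ G (externalCorner G r j)))       ∎
    where open ≡-Reasoning

  colour-externalVertex : ∀ {j k} → j < D → SameVertex G (externalCorner G r j) k → ℓ k ≡ suc j
  colour-externalVertex {j} {k} j<D u~k =
    trans (external-vertex-rule (fromℕ< j<D) k (subst (λ i → SameVertex G (externalCorner G r i) k)
                                                      (sym (toℕ-fromℕ< j<D)) u~k))
          (cong suc (toℕ-fromℕ< j<D))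

  agrees-externalVertex : ∀ {h k} → ExternalCorner G r h → SameVertex G h k → Agrees k
  agrees-externalVertex {k = k} h-ext h~k with external⇒walk h-ext
  ... | j , j<D , refl = begin
    parity (ℓ k)                       ≡⟨ cong parity (colour-externalVertex j<D h~k) ⟩
    parity (suc j)                     ≡⟨ shade-externalCorner j ⟩
    shade (col (externalCorner G r j)) ≡⟨ cong shade (sym (colour-sameVertex h~k)) ⟩
    shade (col k)                      ∎
    where open ≡-Reasoning

  agrees-external : ∀ {k} → ExternalCorner G r k → Agrees k
  agrees-external k-ext = agrees-externalVertex k-ext (0 , refl)

  -- a face step preserves agreement: along an internal face both the colour
  -- parity and the shade flip, and the external face agrees throughout
  agrees-φ⁺ : ∀ k → Agrees (φ⁺ G k) ⇔ Agrees k
  agrees-φ⁺ k with external? k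
  ... | yes (i , eq) = mk⇔ (λ _ → agrees-external (i , eq))
                           (λ _ → agrees-external (suc i , cong (φ⁺ G) eq))
  ... | no k-int = flip-agree parity-flips (shade-≢ (colour-φ⁺ k))
    where
    parity-flips : parity (ℓ (φ⁺ G k)) ≡ parity (ℓ k) ⁻¹
    parity-flips = trans (parity-congruent D-even (internal-face-rule k k-int)) (parity-+1 (ℓ k))

  module _ (even : IsEvenLabelling G r D ℓ) where

    parity-internalArc : ∀ k → InternalEdge G r k → parity (ℓ k) ≡ parity (ℓ (σ⁺ G k))
    parity-internalArc k internal
      with jump-exists (proj₁ (colours-in-range k)) (proj₂ (colours-in-range k))
                       (proj₂ (colours-in-range (σ⁺ G k)))
    ... | j , j<D , congruent = to (jump-even⇔ D-even congruent) (even k internal j (j<D , congruent))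

    -- a rotation step preserves agreement: across an internal edge by the even
    -- jump, otherwise because the edge ends at an external vertex
    agrees-σ : ∀ k → Agrees k → Agrees (σ⁺ G k)
    agrees-σ k k-agrees with external? (σ⁺ G k) | external? (σ⁺ G (α⁺ G k))
    ... | yes σk-ext | _ = agrees-external σk-ext
    ... | no _ | yes σαk-ext =
      to (agrees-φ⁺ (σ⁺ G k))
         (subst Agrees (sym (φ⁺-σ k)) (agrees-externalVertex σαk-ext (sameVertex-sym (1 , refl))))
    ... | no σk-int | no σαk-int = begin
      parity (ℓ (σ⁺ G k))    ≡⟨ sym (parity-internalArc k (σk-int , σαk-int)) ⟩
      parity (ℓ k)           ≡⟨ k-agrees ⟩
      shade (col k)          ≡⟨ cong shade (sym (proj₁ proper k)) ⟩
      shade (col (σ⁺ G k))   ∎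
      where open ≡-Reasoning

    -- crossing an edge is a rotation step followed by a face step
    agrees-α : ∀ k → Agrees k → Agrees (α⁺ G k)
    agrees-α k k-agrees = subst Agrees (φ⁺-σ k) (from (agrees-φ⁺ (σ⁺ G k)) (agrees-σ k k-agrees))

    even⇒agrees : Connected G → ∀ k → Agrees k
    even⇒agrees connected k =
      reach-ind Agrees (agrees-external (0 , refl)) agrees-σ agrees-α (connected r k)

  -- if all corners agree, both corners around an arc have the parity of its vertex
  agrees⇒even : (∀ k → Agrees k) → IsEvenLabelling G r D ℓ
  agrees⇒even agree h _ j (_ , congruent) = from (jump-even⇔ D-even congruent)
    (trans (agree h) (trans (cong shade (sym (proj₁ proper h))) (sym (agree (σ⁺ G h)))))

lemma5p1 : (p : ℕ) → 2 ≤ p → {n : ℕ} → (G : Map n) → (r : Fin n) →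
    IsPlaneGraph G → AllFacesDegree G (2 * p) → HasGirth G (2 * p) →
    (col : Fin n → Bool) → IsProperColouring G col → col r ≡ true →
    (ℓ : Fin n → ℕ) → IsClockwiseLabelling G r (2 * p) ℓ →
    IsEvenLabelling G r (2 * p) ℓ ⇔
    (∀ k → (col k ≡ true → Odd (ℓ k)) × (col k ≡ false → Even (ℓ k)))
lemma5p1 p 2≤p G r (_ , _ , connected , (_ , _ , vertexOrbits , _ , _)) faces _
         col proper r-black ℓ labelling =
  mk⇔ (λ even k → to (parity≡shade⇔ (ℓ k) (col k)) (even⇒agrees even connected k))
      (λ condition → agrees⇒even (λ k → from (parity≡shade⇔ (ℓ k) (col k)) (condition k)))
  where
  0<2p : 0 < 2 * p
  0<2p = ≤-trans (≤-trans (s≤s z≤n) 2≤p) (m≤n*m p 2)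
  open Agreement G r 0<2p (m∣m*n p) (proj₁ (faces r)) (sameOrbit-sym vertexOrbits)
                 proper r-black labelling
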